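{- For every odd integer $n\ge 3$, the Cartesian product $C_n\square C_n$ of two directed cycles of length $n$ contains an independent dominating set.
   Context: $C_n$ denotes the directed cycle with vertices $v_0,\dots,v_{n-1}$ and arcs $(v_i,v_{i+1})$, indices modulo $n$. The Cartesian product $G\square H$ of digraphs has vertex set $V(G)\times V(H)$ and an arc from $(x,u)$ to $(y,v)$ iff either $(x,y)\in A(G)$ and $u=v$, or $(u,v)\in A(H)$ and $x=y$. In a digraph, a set $S$ is independent if no arc joins two vertices of $S$, dominating if every vertex not in $S$ has an in-neighbour in $S$, and an independent dominating set if both. -}

module Defs where

open import Data.Nat using (ℕ; suc; zero; _∸_)
open import Data.Fin using (Fin; toℕ)
open import Data.Product using (_×_; _,_; ∃)
open import Data.Sum using (_⊎_)
open import Relation.Binary.PropositionalEquality using (_≡_)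
open import Relation.Nullary using (¬_)

record Digraph : Set₁ where
  field
    Vertex : Set
    Arc    : Vertex → Vertex → Set
open Digraph public

-- Directed cycle C_n on vertices v_0..v_{n-1} (as Fin n), arcs (v_i, v_{i+1 mod n}).
-- i.e. toℕ j ≡ (toℕ i + 1) mod n, written out: either j = i+1, or i = n-1 and j = 0.
Cycle : ℕ → Digraph
Cycle n = record
  { Vertex = Fin n
  ; Arc    = λ i j → (toℕ j ≡ suc (toℕ i)) ⊎ (toℕ i ≡ n ∸ 1 × toℕ j ≡ zero)
  }

_□_ : Digraph → Digraph → Digraph
G □ H = record
  { Vertex = Vertex G × Vertex H
  ; Arc    = λ { (x , u) (y , v) → (Arc G x y × u ≡ v) ⊎ (Arc H u v × x ≡ y) }
  }

VSet : Digraph → Set₁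
VSet G = Vertex G → Set

Independent : (G : Digraph) → VSet G → Set
Independent G S = ∀ x y → S x → S y → ¬ Arc G x y

Dominating : (G : Digraph) → VSet G → Set
Dominating G S = ∀ v → ¬ S v → ∃ λ u → S u × Arc G u v

IndependentDominating : (G : Digraph) → VSet G → Set
IndependentDominating G S = Independent G S × Dominating G S

module Submission where

open import Defs
open import Data.Nat using (ℕ; zero; suc; _+_; _∸_; _≤_; _<_; _≥_; z≤n; s≤s; _≤?_; parity)
open import Data.Nat.Divisibility using (_∣_)
open import Data.Nat.Properties
open import Data.Fin using (Fin; zero; suc; toℕ; fromℕ; inject₁)
open import Data.Fin.Properties using (toℕ≤pred[n]; toℕ-fromℕ; toℕ-inject₁)
open import Data.Parity using (0ℙ; 1ℙ; _⁻¹)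
open import Data.Parity.Properties using (suc-homo-⁻¹; ⁻¹-selfInverse; p≢p⁻¹)
open import Data.Product using (Σ; _×_; _,_; ∃)
open import Data.Sum using (_⊎_; inj₁; inj₂)
open import Relation.Nullary using (¬_; yes; no; contradiction)
open import Relation.Binary.PropositionalEquality

-- Index the vertex (x , u) of C_n □ C_n by its diagonal x − u mod n. An arc
-- in the first factor raises the diagonal by one, an arc in the second
-- lowers it by one, so the problem reduces to the cycle of diagonals seen as
-- an undirected graph. There the values that are even and different from
-- n − 1 form an independent set, every odd value is preceded by a chosen one,
-- and n − 1 (when it is even) is followed by the chosen value 0.

∸≡suc∸suc : ∀ {a b} → b < a → a ∸ b ≡ suc (a ∸ suc b)
∸≡suc∸suc {suc a} (s≤s b≤a) = +-∸-assoc 1 b≤a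

parity-suc : ∀ n → parity (suc n) ≡ parity n ⁻¹
parity-suc n = sym (⁻¹-selfInverse (suc-homo-⁻¹ n))

cycle-predecessor : ∀ {m} (y : Fin (suc m)) → ∃ λ x → Arc (Cycle (suc m)) x y
cycle-predecessor {m} zero = fromℕ m , inj₂ (toℕ-fromℕ m , refl)
cycle-predecessor (suc y) = inject₁ y , inj₁ (cong suc (sym (toℕ-inject₁ y)))

module Diagonal (m : ℕ) where

  -- Arc (Cycle (suc m)) x y is definitionally CyclicArc (toℕ x) (toℕ y).
  CyclicArc : ℕ → ℕ → Set
  CyclicArc a b = (b ≡ suc a) ⊎ (a ≡ m × b ≡ zero)

  diag : ℕ → ℕ → ℕ
  diag i j with j ≤? i
  ... | yes _ = i ∸ j
  ... | no  _ = suc m + i ∸ j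

  diag-of-≤ : ∀ {i j} → j ≤ i → diag i j ≡ i ∸ j
  diag-of-≤ {i} {j} j≤i with j ≤? i
  ... | yes _   = refl
  ... | no  j≰i = contradiction j≤i j≰i

  diag-of-> : ∀ {i j} → i < j → diag i j ≡ suc m + i ∸ j
  diag-of-> {i} {j} i<j with j ≤? i
  ... | yes j≤i = contradiction i<j (≤⇒≯ j≤i)
  ... | no  _   = refl

  diag≤m : ∀ {i j} → i ≤ m → j ≤ m → diag i j ≤ m
  diag≤m {i} {j} i≤m j≤m with j ≤? i
  ... | yes _   = ≤-trans (m∸n≤m i j) i≤m
  ... | no  j≰i = begin
    suc m + i ∸ j   ≤⟨ ∸-monoʳ-≤ (suc m + i) (≰⇒> j≰i) ⟩
    suc m + i ∸ suc i ≡⟨ m+n∸n≡m m i ⟩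
    m               ∎
    where open ≤-Reasoning

  diag-arcˡ : ∀ {i i'} j → j ≤ m → CyclicArc i i' → CyclicArc (diag i j) (diag i' j)
  diag-arcˡ {i} j j≤m (inj₁ refl) with j ≤? i
  ... | yes j≤i = inj₁ (trans (diag-of-≤ (m≤n⇒m≤1+n j≤i)) (+-∸-assoc 1 j≤i))
  ... | no  j≰i with j ≤? suc i
  ...   | yes j≤1+i rewrite ≤-antisym j≤1+i (≰⇒> j≰i) =
          inj₂ (m+n∸n≡m m i , n∸n≡0 (suc i))
  ...   | no  _ = inj₁ (trans (cong (_∸ j) (+-suc (suc m) i))
                              (+-∸-assoc 1 (m≤n⇒m≤1+n (≤-trans j≤m (m≤m+n m i)))))
  diag-arcˡ zero    _   (inj₂ (refl , refl)) = inj₂ (diag-of-≤ z≤n , refl)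
  diag-arcˡ (suc k) k<m (inj₂ (refl , refl)) = inj₁ (begin
    diag 0 (suc k)   ≡⟨ diag-of-> {0} {suc k} (s≤s z≤n) ⟩
    m + 0 ∸ k        ≡⟨ cong (_∸ k) (+-identityʳ m) ⟩
    m ∸ k            ≡⟨ ∸≡suc∸suc k<m ⟩
    suc (m ∸ suc k)  ≡⟨ cong suc (diag-of-≤ k<m) ⟨
    suc (diag m (suc k)) ∎)
    where open ≡-Reasoning

  diag-arcʳ : ∀ i {j j'} → i ≤ m → j ≤ m → CyclicArc j j' → CyclicArc (diag i j') (diag i j)
  diag-arcʳ i {j} _ j≤m (inj₁ refl) with suc j ≤? i
  ... | yes j<i = inj₁ (trans (diag-of-≤ (<⇒≤ j<i)) (∸≡suc∸suc j<i))
  ... | no  j≮i with j ≤? i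
  ...   | yes j≤i rewrite ≤-antisym j≤i (≤-pred (≰⇒> j≮i)) =
          inj₂ (m+n∸n≡m m i , n∸n≡0 i)
  ...   | no  _ = inj₁ (+-∸-assoc 1 (≤-trans j≤m (m≤m+n m i)))
  diag-arcʳ i i≤m _ (inj₂ (refl , refl)) with m ≤? i
  ... | yes m≤i rewrite ≤-antisym i≤m m≤i = inj₂ (refl , n∸n≡0 m)
  ... | no  _   = inj₁ (trans (+-∸-assoc 1 (m≤m+n m i)) (cong suc (m+n∸m≡n m i)))

  Selected : ℕ → Set
  Selected d = parity d ≡ 0ℙ × d ≢ m

  Selected-independent : ∀ {a b} → Selected a → Selected b → ¬ CyclicArc a b
  Selected-independent {a} (even-a , _) (even-b , _) (inj₁ refl) =
    p≢p⁻¹ (parity a) (trans even-a (trans (sym even-b) (parity-suc a)))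
  Selected-independent (_ , a≢m) _ (inj₂ (a≡m , _)) = a≢m a≡m

  Selected-dominating : m ≢ 0 → ∀ {d} → d ≤ m → ¬ Selected d →
    (∀ {c} → CyclicArc c d → Selected c) ⊎ (∀ {c} → c ≤ m → CyclicArc d c → Selected c)
  Selected-dominating m≢0 {d} d≤m ¬sel-d with parity d in d-parity
  ... | 1ℙ = inj₁ from-below
    where
      from-below : ∀ {c} → CyclicArc c d → Selected c
      from-below {c} (inj₁ d≡1+c) =
          sym (⁻¹-selfInverse (trans (sym (parity-suc c)) (trans (cong parity (sym d≡1+c)) d-parity)))
        , λ c≡m → <-irrefl c≡m (subst (_≤ m) d≡1+c d≤m)
      from-below (inj₂ (_ , refl)) = contradiction d-parity λ ()
  ... | 0ℙ = inj₂ from-above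
    where
      from-above : ∀ {c} → c ≤ m → CyclicArc d c → Selected c
      from-above c≤m (inj₁ refl) = contradiction (refl , λ d≡m → <-irrefl d≡m c≤m) ¬sel-d
      from-above _   (inj₂ (_ , refl)) = refl , λ 0≡m → m≢0 (sym 0≡m)

  Torus : Digraph
  Torus = Cycle (suc m) □ Cycle (suc m)

  diagonalSet : VSet Torus
  diagonalSet (x , u) = Selected (diag (toℕ x) (toℕ u))

  toℕ≤m : (x : Fin (suc m)) → toℕ x ≤ m
  toℕ≤m = toℕ≤pred[n]

  diagonalSet-independent : Independent Torus diagonalSet
  diagonalSet-independent (x , u) (y , .u) sel-xu sel-yu (inj₁ (x→y , refl)) =
    Selected-independent sel-xu sel-yu (diag-arcˡ (toℕ u) (toℕ≤m u) x→y)
  diagonalSet-independent (x , u) (.x , v) sel-xu sel-xv (inj₂ (u→v , refl)) =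
    Selected-independent sel-xv sel-xu (diag-arcʳ (toℕ x) (toℕ≤m x) (toℕ≤m u) u→v)

  diagonalSet-dominating : m ≢ 0 → Dominating Torus diagonalSet
  diagonalSet-dominating m≢0 (y , v) ¬sel-yv
    with Selected-dominating m≢0 (diag≤m (toℕ≤m y) (toℕ≤m v)) ¬sel-yv
  ... | inj₁ from-below with cycle-predecessor y
  ...   | x , x→y = (x , v) , from-below (diag-arcˡ (toℕ v) (toℕ≤m v) x→y) , inj₁ (x→y , refl)
  diagonalSet-dominating _ (y , v) _ | inj₂ from-above with cycle-predecessor v
  ...   | u , u→v = (y , u)
                  , from-above (diag≤m (toℕ≤m y) (toℕ≤m u)) (diag-arcʳ (toℕ y) (toℕ≤m y) (toℕ≤m u) u→v)
                  , inj₂ (u→v , refl)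

mainTheorem8 : (n : ℕ) → n ≥ 3 → ¬ (2 ∣ n) →
    Σ (VSet (Cycle n □ Cycle n)) (λ S → IndependentDominating (Cycle n □ Cycle n) S)
mainTheorem8 (suc (suc (suc k))) (s≤s (s≤s (s≤s z≤n))) _ =
  diagonalSet , diagonalSet-independent , diagonalSet-dominating (λ ())
  where open Diagonal (suc (suc k))
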